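{- For every graph $H$, $R(H, K_{n,n}) = O(n^{\Delta(H)})$, where the implied constant depends only on $H$.
   Context: $\Delta(H)$ is the maximum degree of $H$. For graphs $H$ and $F$, $R(H,F)$ is the smallest $N$ such that for every graph $G$ on $N$ vertices, either $G$ contains a copy of $H$ or its complement $\overline{G}$ contains a copy of $F$. $K_{n,n}$ is the complete bipartite graph with both sides of size $n$. -}

module Defs where

open import Data.Nat using (ℕ; zero; suc; _⊔_; _+_)
open import Data.Bool using (Bool; true; false; not)
open import Data.Fin using (Fin)
open import Data.Sum using (_⊎_; inj₁; inj₂)
open import Data.Product using (Σ; _×_)
open import Relation.Binary.PropositionalEquality using (_≡_; _≢_)
open import Function.Definitions using (Injective)

record Graph (k : ℕ) : Set where
  field
    adj   : Fin k → Fin k → Bool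
    sym   : ∀ u v → adj u v ≡ adj v u
    irrefl : ∀ v → adj v v ≡ false
open Graph public

count : ∀ {m} → (Fin m → Bool) → ℕ
count {zero}  f = 0
count {suc m} f = (if-true (f Fin.zero)) + count (λ i → f (Fin.suc i))
  where
  if-true : Bool → ℕ
  if-true true  = 1
  if-true false = 0

degree : ∀ {k} → Graph k → Fin k → ℕ
degree G v = count (adj G v)

maxFin : ∀ {m} → (Fin m → ℕ) → ℕ
maxFin {zero}  f = 0
maxFin {suc m} f = f Fin.zero ⊔ maxFin (λ i → f (Fin.suc i))

Δ : ∀ {k} → Graph k → ℕ
Δ H = maxFin (degree H)

Contains : ∀ {h N} → Graph N → Graph h → Set
Contains {h} {N} G H =
  Σ (Fin h → Fin N) λ f →
    Injective _≡_ _≡_ f × (∀ u v → adj H u v ≡ true → adj G (f u) (f v) ≡ true)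

-- the complement of G contains a copy of K_{n,n}: an injective map from
-- the two sides (Fin n ⊎ Fin n) such that every cross pair is a non-edge of G
-- (distinct vertices, so a non-edge of G is an edge of the complement).
ComplContainsKnn : ∀ {N} → Graph N → ℕ → Set
ComplContainsKnn {N} G n =
  Σ (Fin n ⊎ Fin n → Fin N) λ f →
    Injective _≡_ _≡_ f × (∀ a b → adj G (f (inj₁ a)) (f (inj₂ b)) ≡ false)

-- Embed H greedily, one vertex at a time.  A vertex w not yet embedded keeps a candidate set
-- C w (the common neighbourhood in G of the images of its embedded neighbours) of size at least
-- (K + m) n^m, where m bounds the number of its neighbours still to be embedded.  If n vertices
-- of G each had fewer than t neighbours in a set A with |A| ≥ n t + n, then removing their closed
-- neighbourhoods from A would leave n more vertices, and the two n-sets would span a K_{n,n} in the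
-- complement of G.  So, unless the complement contains K_{n,n}, fewer than n images of the next
-- vertex shrink the candidate set of a given neighbour by more than a factor n; avoiding these
-- at most n Δ bad images and the fewer than K vertices already used still leaves a choice.
-- With K = h and m = Δ(H) this needs N ≥ (h + Δ(H)) n^Δ(H).
module Submission where

open import Defs renaming (sym to adj-sym)
open import Data.Nat using (ℕ; zero; suc; _+_; _*_; _∸_; _^_; _≤_; _<_; _<ᵇ_; _≤?_; z≤n; s≤s; z<s; NonZero)
open import Data.Nat.Properties
open import Data.Nat.Tactic.RingSolver using (solve-∀)
open import Data.Bool using (Bool; true; false; _∧_; _∨_; not; T; if_then_else_)
open import Data.Bool.Properties using (∧-identityʳ; ∧-conicalˡ; ∧-conicalʳ; ∨-conicalˡ; ∨-conicalʳ; not-injective; T-≡)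
open import Data.Fin using (Fin; zero; suc)
open import Data.Product using (Σ; ∃; ∃-syntax; _×_; _,_; proj₁; proj₂; map₂)
open import Data.Empty using (⊥-elim)
open import Data.Sum using (_⊎_; inj₁; inj₂; [_,_])
import Data.Sum as Sum
open import Data.Vec.Functional using (tail; _∷_; foldr)
open import Function.Bundles using (Equivalence)
open import Function.Definitions using (Injective)
open import Relation.Nullary using (yes; no)
open import Relation.Binary.PropositionalEquality using (_≡_; _≢_; refl; sym; trans; cong; cong₂; subst)

toℕ : Bool → ℕ
toℕ true  = 1
toℕ false = 0

VertexSet : ℕ → Set
VertexSet N = Fin N → Bool

module _ {N : ℕ} where
  ∅ full : VertexSet N
  ∅ _ = false
  full _ = true

  _∪_ _∩_ _∖_ : VertexSet N → VertexSet N → VertexSet N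
  (A ∪ B) x = A x ∨ B x
  (A ∩ B) x = A x ∧ B x
  (A ∖ B) x = A x ∧ not (B x)

_==_ : ∀ {N} → Fin N → Fin N → Bool
zero   == zero   = true
zero   == suc _ = false
suc _ == zero   = false
suc x == suc y = x == y

==-refl : ∀ {N} (x : Fin N) → (x == x) ≡ true
==-refl zero     = refl
==-refl (suc x) = ==-refl x

⁅_⁆ : ∀ {N} → Fin N → VertexSet N
⁅ x ⁆ = x ==_

count-suc : ∀ {N} (A : VertexSet (suc N)) → count A ≡ toℕ (A zero) + count (tail A)
count-suc A with A zero
... | true  = refl
... | false = refl

count-∅ : ∀ {N} → count (∅ {N}) ≡ 0
count-∅ {zero}  = refl
count-∅ {suc N} = count-∅ {N}

count-full : ∀ {N} → count (full {N}) ≡ N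
count-full {zero}  = refl
count-full {suc N} = cong suc (count-full {N})

count-⁅⁆ : ∀ {N} (x : Fin N) → count ⁅ x ⁆ ≡ 1
count-⁅⁆ {suc N} zero     = cong suc (count-∅ {N})
count-⁅⁆ {suc N} (suc x) = count-⁅⁆ x

toℕ-cover : ∀ {a b c : Bool} → (a ≡ true → b ≡ true ⊎ c ≡ true) → toℕ a ≤ toℕ b + toℕ c
toℕ-cover {false}                 _ = z≤n
toℕ-cover {true} {true}           _ = s≤s z≤n
toℕ-cover {true} {false} {true}   _ = s≤s z≤n
toℕ-cover {true} {false} {false} a⊆b∪c with a⊆b∪c refl
... | inj₁ ()
... | inj₂ ()

count-cover : ∀ {N} (A B C : VertexSet N) → (∀ x → A x ≡ true → B x ≡ true ⊎ C x ≡ true) →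
              count A ≤ count B + count C
count-cover {zero}  A B C _     = z≤n
count-cover {suc N} A B C A⊆B∪C = begin
  count A
    ≡⟨ count-suc A ⟩
  toℕ (A zero) + count (tail A)
    ≤⟨ +-mono-≤ (toℕ-cover (A⊆B∪C zero)) (count-cover (tail A) (tail B) (tail C) (λ x → A⊆B∪C (suc x))) ⟩
  (toℕ (B zero) + toℕ (C zero)) + (count (tail B) + count (tail C))
    ≡⟨ interchange (toℕ (B zero)) _ _ _ ⟩
  (toℕ (B zero) + count (tail B)) + (toℕ (C zero) + count (tail C))
    ≡⟨ sym (cong₂ _+_ (count-suc B) (count-suc C)) ⟩
  count B + count C ∎
  where
  open ≤-Reasoning
  interchange : ∀ a b c d → (a + b) + (c + d) ≡ (a + c) + (b + d)
  interchange = solve-∀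

count-∪ : ∀ {N} (A B : VertexSet N) → count (A ∪ B) ≤ count A + count B
count-∪ A B = count-cover (A ∪ B) A B (λ x → ∨-elim)
  where
  ∨-elim : ∀ {a b} → a ∨ b ≡ true → a ≡ true ⊎ b ≡ true
  ∨-elim {true}  _   = inj₁ refl
  ∨-elim {false} b≡t = inj₂ b≡t

count-∖ : ∀ {N} (A B : VertexSet N) → count A ≤ count (A ∖ B) + count B
count-∖ A B = count-cover A (A ∖ B) B split
  where
  split : ∀ x → A x ≡ true → (A ∖ B) x ≡ true ⊎ B x ≡ true
  split x Ax≡t with B x
  ... | true  = inj₂ refl
  ... | false = inj₁ (trans (∧-identityʳ (A x)) Ax≡t)

∖-elim : ∀ {N} (A B : VertexSet N) {x} → (A ∖ B) x ≡ true → A x ≡ true × B x ≡ false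
∖-elim A B {x} x∈A∖B =
  ∧-conicalˡ (A x) _ x∈A∖B , not-injective (∧-conicalʳ (A x) _ x∈A∖B)

⁅⁆-false⇒≢ : ∀ {N} {x y : Fin N} → ⁅ x ⁆ y ≡ false → x ≢ y
⁅⁆-false⇒≢ {x = x} x≠ᵇy refl with () ← trans (sym (==-refl x)) x≠ᵇy

count-pos : ∀ {N} (A : VertexSet N) {x} → A x ≡ true → 0 < count A
count-pos A {zero}   Ax≡t rewrite count-suc A | Ax≡t = s≤s z≤n
count-pos A {suc x} Ax≡t rewrite count-suc A =
  m≤n⇒m≤o+n (toℕ (A zero)) (count-pos (tail A) Ax≡t)

count-pos⇒∃ : ∀ {N} (A : VertexSet N) → 0 < count A → ∃ λ x → A x ≡ true
count-pos⇒∃ {suc N} A pos with A zero in Az≡t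
... | true  = zero , Az≡t
... | false with x , Ax≡t ← count-pos⇒∃ (tail A) pos = suc x , Ax≡t

count-tail : ∀ {N} (A : VertexSet (suc N)) → count (tail A) ≤ count A
count-tail A = ≤-trans (m≤n+m _ (toℕ (A zero))) (≤-reflexive (sym (count-suc A)))

count-exceeds : ∀ {N} (A B : VertexSet N) → count B < count A → ∃ λ x → A x ≡ true × B x ≡ false
count-exceeds A B B<A = map₂ (∖-elim A B) (count-pos⇒∃ (A ∖ B) A∖B-pos)
  where
  A∖B-pos : 0 < count (A ∖ B)
  A∖B-pos = +-cancelʳ-< (count B) 0 (count (A ∖ B)) (<-≤-trans B<A (count-∖ A B))

count-∖⁅⁆ : ∀ {N} (A : VertexSet N) x → count A ≤ suc (count (A ∖ ⁅ x ⁆))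
count-∖⁅⁆ A x = begin
  count A                          ≤⟨ count-∖ A ⁅ x ⁆ ⟩
  count (A ∖ ⁅ x ⁆) + count ⁅ x ⁆  ≡⟨ cong (count (A ∖ ⁅ x ⁆) +_) (count-⁅⁆ x) ⟩
  count (A ∖ ⁅ x ⁆) + 1            ≡⟨ +-comm _ 1 ⟩
  suc (count (A ∖ ⁅ x ⁆))          ∎
  where open ≤-Reasoning

count-∪⁅⁆ : ∀ {N} (A : VertexSet N) x → count (A ∪ ⁅ x ⁆) ≤ suc (count A)
count-∪⁅⁆ A x = begin
  count (A ∪ ⁅ x ⁆)        ≤⟨ count-∪ A ⁅ x ⁆ ⟩
  count A + count ⁅ x ⁆    ≡⟨ cong (count A +_) (count-⁅⁆ x) ⟩
  count A + 1              ≡⟨ +-comm (count A) 1 ⟩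
  suc (count A)            ∎
  where open ≤-Reasoning

Distinct : ∀ {N} → ℕ → VertexSet N → Set
Distinct {N} m A = Σ (Fin m → Fin N) λ e → Injective _≡_ _≡_ e × (∀ i → A (e i) ≡ true)

distinct-elements : ∀ {N} m (A : VertexSet N) → m ≤ count A → Distinct m A
distinct-elements zero    A _ = (λ ()) , (λ { {()} }) , (λ ())
distinct-elements (suc m) A m<count
  with x , Ax≡t ← count-pos⇒∃ A (<-≤-trans z<s m<count)
  with e , e-injective , e∈A∖x ← distinct-elements m (A ∖ ⁅ x ⁆)
                                     (≤-pred (≤-trans m<count (count-∖⁅⁆ A x)))
  = x ∷ e , injective , ∈A
  where
  x≢e : ∀ i → x ≢ e i
  x≢e i = ⁅⁆-false⇒≢ (proj₂ (∖-elim A ⁅ x ⁆ (e∈A∖x i)))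
  injective : Injective _≡_ _≡_ (x ∷ e)
  injective {zero}   {zero}   _   = refl
  injective {zero}   {suc j} x≡ej = ⊥-elim (x≢e j x≡ej)
  injective {suc i} {zero}   ei≡x = ⊥-elim (x≢e i (sym ei≡x))
  injective {suc i} {suc j} ei≡ej = cong suc (e-injective ei≡ej)
  ∈A : ∀ i → A ((x ∷ e) i) ≡ true
  ∈A zero     = Ax≡t
  ∈A (suc i) = proj₁ (∖-elim A ⁅ x ⁆ (e∈A∖x i))

⋃[_]_ : ∀ {k N} → (Fin k → Bool) → (Fin k → VertexSet N) → VertexSet N
(⋃[ S ] P) x = foldr _∨_ false (λ j → S j ∧ P j x)

⋃-false : ∀ {k N} (S : Fin k → Bool) (P : Fin k → VertexSet N) {x} → (⋃[ S ] P) x ≡ false →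
          ∀ j → S j ≡ true → P j x ≡ false
⋃-false S P x∉⋃ zero Sj≡t rewrite Sj≡t = ∨-conicalˡ (P zero _) _ x∉⋃
⋃-false S P x∉⋃ (suc j) = ⋃-false (tail S) (tail P) (∨-conicalʳ (S zero ∧ P zero _) _ x∉⋃) j

count-⋃ : ∀ {k N} (S : Fin k → Bool) (P : Fin k → VertexSet N) t →
          (∀ j → S j ≡ true → count (P j) ≤ t) → count (⋃[ S ] P) ≤ count S * t
count-⋃ {zero}  {N} S P t _ = ≤-reflexive (count-∅ {N})
count-⋃ {suc k} {N} S P t P≤t = begin
  count (⋃[ S ] P)
    ≤⟨ count-∪ (λ x → S zero ∧ P zero x) (⋃[ tail S ] tail P) ⟩
  count (λ x → S zero ∧ P zero x) + count (⋃[ tail S ] tail P)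
    ≤⟨ +-mono-≤ head-bound (count-⋃ (tail S) (tail P) t (λ j → P≤t (suc j))) ⟩
  toℕ (S zero) * t + count (tail S) * t
    ≡⟨ sym (*-distribʳ-+ t (toℕ (S zero)) _) ⟩
  (toℕ (S zero) + count (tail S)) * t
    ≡⟨ cong (_* t) (sym (count-suc S)) ⟩
  count S * t ∎
  where
  open ≤-Reasoning
  head-bound : count (λ x → S zero ∧ P zero x) ≤ toℕ (S zero) * t
  head-bound with S zero in S0≡t
  ... | true  = ≤-trans (P≤t zero S0≡t) (≤-reflexive (sym (+-identityʳ t)))
  ... | false = ≤-reflexive (count-∅ {N})

<ᵇ≡true⇒< : ∀ {m n} → (m <ᵇ n) ≡ true → m < n
<ᵇ≡true⇒< {m} {n} m<ᵇn = <ᵇ⇒< m n (Equivalence.from T-≡ m<ᵇn)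

<ᵇ≡false⇒≥ : ∀ {m n} → (m <ᵇ n) ≡ false → n ≤ m
<ᵇ≡false⇒≥ m≮ᵇn = ≮⇒≥ λ m<n → subst T m≮ᵇn (<⇒<ᵇ m<n)

module _ {N} (G : Graph N) where
  lowDegree : VertexSet N → ℕ → VertexSet N
  lowDegree A t x = count (A ∩ adj G x) <ᵇ t

  complement-Knn : ∀ {n} (e a : Fin n → Fin N) → Injective _≡_ _≡_ e → Injective _≡_ _≡_ a →
                   (∀ k l → e k ≢ a l) → (∀ k l → adj G (e k) (a l) ≡ false) → ComplContainsKnn G n
  complement-Knn e a e-injective a-injective e≢a e≁a = [ e , a ] , injective , e≁a
    where
    injective : Injective _≡_ _≡_ [ e , a ]
    injective {inj₁ k} {inj₁ l} ek≡el = cong inj₁ (e-injective ek≡el)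
    injective {inj₁ k} {inj₂ l} ek≡al with () ← e≢a k l ek≡al
    injective {inj₂ k} {inj₁ l} ak≡el with () ← e≢a l k (sym ak≡el)
    injective {inj₂ k} {inj₂ l} ak≡al = cong inj₂ (a-injective ak≡al)

  lowDegree-Knn : ∀ {n} (A : VertexSet N) t → n * t + n ≤ count A →
                  Distinct n (lowDegree A t) → ComplContainsKnn G n
  lowDegree-Knn {n} A t n*t+n≤A (e , e-injective , e-low) =
    outside-Knn (distinct-elements n (A ∖ Z) n≤A∖Z)
    where
    Nbhd : Fin n → VertexSet N
    Nbhd k = (A ∩ adj G (e k)) ∪ ⁅ e k ⁆
    Z : VertexSet N
    Z = ⋃[ full ] Nbhd
    count-Nbhd : ∀ k → true ≡ true → count (Nbhd k) ≤ t
    count-Nbhd k _ = begin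
      count (Nbhd k)                          ≤⟨ count-∪ (A ∩ adj G (e k)) ⁅ e k ⁆ ⟩
      count (A ∩ adj G (e k)) + count ⁅ e k ⁆ ≡⟨ cong (count (A ∩ adj G (e k)) +_) (count-⁅⁆ (e k)) ⟩
      count (A ∩ adj G (e k)) + 1             ≡⟨ +-comm _ 1 ⟩
      suc (count (A ∩ adj G (e k)))           ≤⟨ <ᵇ≡true⇒< (e-low k) ⟩
      t                                       ∎
      where open ≤-Reasoning
    n≤A∖Z : n ≤ count (A ∖ Z)
    n≤A∖Z = +-cancelˡ-≤ (n * t) n (count (A ∖ Z)) (begin
      n * t + n                            ≤⟨ n*t+n≤A ⟩
      count A                              ≤⟨ count-∖ A Z ⟩
      count (A ∖ Z) + count Z              ≤⟨ +-monoʳ-≤ (count (A ∖ Z)) (count-⋃ full Nbhd t count-Nbhd) ⟩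
      count (A ∖ Z) + count (full {n}) * t ≡⟨ cong (λ c → count (A ∖ Z) + c * t) (count-full {n}) ⟩
      count (A ∖ Z) + n * t                ≡⟨ +-comm (count (A ∖ Z)) (n * t) ⟩
      n * t + count (A ∖ Z)                ∎)
      where open ≤-Reasoning
    outside-Knn : Distinct n (A ∖ Z) → ComplContainsKnn G n
    outside-Knn (a , a-injective , a∈A∖Z) = complement-Knn e a e-injective a-injective e≢a e≁a
      where
      al∉Nbhd : ∀ k l → Nbhd k (a l) ≡ false
      al∉Nbhd k l = ⋃-false full Nbhd (proj₂ (∖-elim A Z (a∈A∖Z l))) k refl
      e≢a : ∀ k l → e k ≢ a l
      e≢a k l = ⁅⁆-false⇒≢ (∨-conicalʳ _ _ (al∉Nbhd k l))
      e≁a : ∀ k l → adj G (e k) (a l) ≡ false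
      e≁a k l = subst (λ b → b ∧ adj G (e k) (a l) ≡ false)
                      (proj₁ (∖-elim A Z (a∈A∖Z l))) (∨-conicalˡ _ _ (al∉Nbhd k l))

  few-lowDegree-or-Knn : ∀ n (A : VertexSet N) t → n * t + n ≤ count A →
                         ComplContainsKnn G n ⊎ count (lowDegree A t) < n
  few-lowDegree-or-Knn n A t n*t+n≤A with n ≤? count (lowDegree A t)
  ... | yes n≤low = inj₁ (lowDegree-Knn A t n*t+n≤A (distinct-elements n (lowDegree A t) n≤low))
  ... | no  n≰low = inj₂ (≰⇒> n≰low)

module Threshold (n K : ℕ) .{{_ : NonZero n}} where
  threshold : ℕ → ℕ
  threshold m = (K + m) * n ^ m

  n≤n^suc : ∀ m → n ≤ n ^ suc m
  n≤n^suc m = m≤m*n n (n ^ m) {{m^n≢0 n m}}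

  threshold-suc : ∀ m → n * threshold m + n ≤ threshold (suc m)
  threshold-suc m = begin
    n * threshold m + n              ≤⟨ +-monoʳ-≤ (n * threshold m) (n≤n^suc m) ⟩
    n * ((K + m) * n ^ m) + n ^ suc m ≡⟨ identity K m n (n ^ m) ⟩
    threshold (suc m)                ∎
    where
    open ≤-Reasoning
    identity : ∀ a b c p → c * ((a + b) * p) + c * p ≡ (a + suc b) * (c * p)
    identity = solve-∀

  K+n*m≤threshold : ∀ m → K + n * m ≤ threshold m
  K+n*m≤threshold m = begin
    K + n * m             ≤⟨ +-mono-≤ (m≤m*n K (n ^ m) {{m^n≢0 n m}}) (n*m≤m*n^m m) ⟩
    K * n ^ m + m * n ^ m ≡⟨ sym (*-distribʳ-+ (n ^ m) K m) ⟩
    threshold m           ∎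
    where
    open ≤-Reasoning
    n*m≤m*n^m : ∀ k → n * k ≤ k * n ^ k
    n*m≤m*n^m zero    = ≤-reflexive (*-zeroʳ n)
    n*m≤m*n^m (suc k) = ≤-trans (≤-reflexive (*-comm n (suc k))) (*-monoʳ-≤ (suc k) (n≤n^suc k))

first-or-all : ∀ {k} {X : Set} {P : Fin k → Set} → (∀ w → X ⊎ P w) → X ⊎ (∀ w → P w)
first-or-all {zero}  _     = inj₂ λ ()
first-or-all {suc k} X⊎P with X⊎P zero | first-or-all (λ w → X⊎P (suc w))
... | inj₁ x  | _       = inj₁ x
... | inj₂ _  | inj₁ x  = inj₁ x
... | inj₂ p₀ | inj₂ ps = inj₂ λ { zero → p₀ ; (suc w) → ps w }

delete₀ : ∀ {h} → Graph (suc h) → Graph h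
delete₀ H = record
  { adj    = λ u v → adj H (suc u) (suc v)
  ; sym    = λ u v → adj-sym H (suc u) (suc v)
  ; irrefl = λ v → irrefl H (suc v)
  }

module Greedy {N} (G : Graph N) (n K : ℕ) .{{_ : NonZero n}} where
  open Threshold n K

  record Embedding {h} (H : Graph h) (C : Fin h → VertexSet N) (U : VertexSet N) : Set where
    field
      φ             : Fin h → Fin N
      injective     : Injective _≡_ _≡_ φ
      homomorphic   : ∀ u v → adj H u v ≡ true → adj G (φ u) (φ v) ≡ true
      in-candidates : ∀ w → C w (φ w) ≡ true
      avoids        : ∀ w → U (φ w) ≡ false

  contains : ∀ {h} {H : Graph h} {C U} → Embedding H C U → Contains G H
  contains ψ = φ , injective , homomorphic
    where open Embedding ψ

  module Root {h} (H : Graph (suc h)) (m : Fin (suc h) → ℕ) (C : Fin (suc h) → VertexSet N)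
              (deg≤m : ∀ w → degree H w ≤ m w) (C-large : ∀ w → threshold (m w) ≤ count (C w)) where
    nbr : Fin h → Bool
    nbr w = adj H zero (suc w)

    low : Fin h → VertexSet N
    low w = lowDegree G (C (suc w)) (threshold (m (suc w) ∸ 1))

    -- the images of the root that would leave some neighbour of it with too few candidates
    Blocked : VertexSet N
    Blocked = ⋃[ nbr ] low

    degree-suc : ∀ w → degree H (suc w) ≡ toℕ (nbr w) + degree (delete₀ H) w
    degree-suc w =
      trans (count-suc (adj H (suc w))) (cong (λ b → toℕ b + degree (delete₀ H) w) (adj-sym H (suc w) zero))

    degree-pos : ∀ w → nbr w ≡ true → 0 < degree H (suc w)
    degree-pos w w~0 = count-pos (adj H (suc w)) (trans (adj-sym H (suc w) zero) w~0)

    few-low-or-Knn : ∀ w → ComplContainsKnn G n ⊎ (nbr w ≡ true → count (low w) < n)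
    few-low-or-Knn w with nbr w in w~0 | m (suc w) | deg≤m (suc w) | C-large (suc w)
    ... | false | _     | _     | _     = inj₂ λ ()
    ... | true  | zero  | deg≤0 | _     = ⊥-elim (n≮0 (<-≤-trans (degree-pos w w~0) deg≤0))
    ... | true  | suc k | _     | C-big =
      Sum.map₂ (λ few _ → few)
        (few-lowDegree-or-Knn G n (C (suc w)) (threshold k) (≤-trans (threshold-suc k) C-big))

    count-Blocked : (∀ w → nbr w ≡ true → count (low w) < n) → count Blocked ≤ n * m zero
    count-Blocked few = begin
      count Blocked ≤⟨ count-⋃ nbr low n (λ w w~0 → <⇒≤ (few w w~0)) ⟩
      count nbr * n ≤⟨ *-monoˡ-≤ n (≤-trans (count-tail (adj H zero)) (deg≤m zero)) ⟩
      m zero * n    ≡⟨ *-comm (m zero) n ⟩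
      n * m zero    ∎
      where open ≤-Reasoning

    choose-root : (U : VertexSet N) → count U < K → (∀ w → nbr w ≡ true → count (low w) < n) →
                  ∃ λ x → C zero x ≡ true × (U ∪ Blocked) x ≡ false
    choose-root U U<K few = count-exceeds (C zero) (U ∪ Blocked) (begin-strict
      count (U ∪ Blocked)     ≤⟨ count-∪ U Blocked ⟩
      count U + count Blocked <⟨ +-mono-<-≤ U<K (count-Blocked few) ⟩
      K + n * m zero          ≤⟨ K+n*m≤threshold (m zero) ⟩
      threshold (m zero)      ≤⟨ C-large zero ⟩
      count (C zero)          ∎)
      where open ≤-Reasoning

    module _ (x : Fin N) where
      m′ : Fin h → ℕ
      m′ w = m (suc w) ∸ toℕ (nbr w)

      C′ : Fin h → VertexSet N
      C′ w = if nbr w then C (suc w) ∩ adj G x else C (suc w)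

      deg≤m′ : ∀ w → degree (delete₀ H) w ≤ m′ w
      deg≤m′ w = m+n≤o⇒m≤o∸n _ (begin
        degree (delete₀ H) w + toℕ (nbr w) ≡⟨ +-comm _ (toℕ (nbr w)) ⟩
        toℕ (nbr w) + degree (delete₀ H) w ≡⟨ sym (degree-suc w) ⟩
        degree H (suc w)                   ≤⟨ deg≤m (suc w) ⟩
        m (suc w)                          ∎)
        where open ≤-Reasoning

      C′-large : Blocked x ≡ false → ∀ w → threshold (m′ w) ≤ count (C′ w)
      C′-large x∉B w with nbr w in w~0
      ... | true  = <ᵇ≡false⇒≥ (⋃-false nbr low x∉B w w~0)
      ... | false = C-large (suc w)

      C′⊆C : ∀ w y → C′ w y ≡ true → C (suc w) y ≡ true
      C′⊆C w y y∈C′ with nbr w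
      ... | true  = ∧-conicalˡ (C (suc w) y) _ y∈C′
      ... | false = y∈C′

      C′⊆adj : ∀ w y → nbr w ≡ true → C′ w y ≡ true → adj G x y ≡ true
      C′⊆adj w y w~0 y∈C′ rewrite w~0 = ∧-conicalʳ (C (suc w) y) _ y∈C′

      extend : (U : VertexSet N) → C zero x ≡ true → U x ≡ false →
               Embedding (delete₀ H) C′ (U ∪ ⁅ x ⁆) → Embedding H C U
      extend U x∈C₀ x∉U ψ = record
        { φ             = x ∷ ψ.φ
        ; injective     = injective
        ; homomorphic   = homomorphic
        ; in-candidates = λ { zero → x∈C₀ ; (suc w) → C′⊆C w _ (ψ.in-candidates w) }
        ; avoids        = λ { zero → x∉U ; (suc w) → ∨-conicalˡ _ _ (ψ.avoids w) }
        }
        where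
        module ψ = Embedding ψ
        x≢ψ : ∀ w → x ≢ ψ.φ w
        x≢ψ w = ⁅⁆-false⇒≢ (∨-conicalʳ _ _ (ψ.avoids w))
        injective : Injective _≡_ _≡_ (x ∷ ψ.φ)
        injective {zero}  {zero}  _     = refl
        injective {zero}  {suc w} x≡ψw  with () ← x≢ψ w x≡ψw
        injective {suc v} {zero}  ψv≡x  with () ← x≢ψ v (sym ψv≡x)
        injective {suc v} {suc w} ψv≡ψw = cong suc (ψ.injective ψv≡ψw)
        homomorphic : ∀ u v → adj H u v ≡ true → adj G ((x ∷ ψ.φ) u) ((x ∷ ψ.φ) v) ≡ true
        homomorphic zero    zero    0~0 with () ← trans (sym 0~0) (irrefl H zero)
        homomorphic zero    (suc w) 0~w = C′⊆adj w _ 0~w (ψ.in-candidates w)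
        homomorphic (suc w) zero    w~0 =
          trans (adj-sym G _ x) (C′⊆adj w _ (trans (adj-sym H zero (suc w)) w~0) (ψ.in-candidates w))
        homomorphic (suc v) (suc w) v~w = ψ.homomorphic v w v~w

  -- H is the part of the pattern still to be embedded, U the set of vertices of G already used,
  -- C w the candidates for w and m w a bound on its degree in H.
  embed : ∀ {h} (H : Graph h) (m : Fin h → ℕ) (C : Fin h → VertexSet N) (U : VertexSet N) →
          count U + h ≤ K → (∀ w → degree H w ≤ m w) → (∀ w → threshold (m w) ≤ count (C w)) →
          ComplContainsKnn G n ⊎ Embedding H C U
  embed {zero} H m C U _ _ _ = inj₂ record
    { φ = λ () ; injective = λ { {()} } ; homomorphic = λ () ; in-candidates = λ () ; avoids = λ () }
  embed {suc h} H m C U U-small deg≤m C-large = embed-root (first-or-all few-low-or-Knn)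
    where
    open Root H m C deg≤m C-large
    1+U+h≤K : suc (count U) + h ≤ K
    1+U+h≤K = subst (_≤ K) (+-suc (count U) h) U-small
    U<K : count U < K
    U<K = m+n≤o⇒m≤o (suc (count U)) 1+U+h≤K
    U′-small : ∀ x → count (U ∪ ⁅ x ⁆) + h ≤ K
    U′-small x = ≤-trans (+-monoˡ-≤ h (count-∪⁅⁆ U x)) 1+U+h≤K
    embed-root : ComplContainsKnn G n ⊎ (∀ w → nbr w ≡ true → count (low w) < n) →
                 ComplContainsKnn G n ⊎ Embedding H C U
    embed-root (inj₁ knn) = inj₁ knn
    embed-root (inj₂ few) with x , x∈C₀ , x∉U∪B ← choose-root U U<K few =
      Sum.map₂ (extend x U x∈C₀ (∨-conicalˡ _ _ x∉U∪B))
        (embed (delete₀ H) (m′ x) (C′ x) (U ∪ ⁅ x ⁆)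
               (U′-small x) (deg≤m′ x) (C′-large x (∨-conicalʳ _ _ x∉U∪B)))

≤-maxFin : ∀ {k} (f : Fin k → ℕ) i → f i ≤ maxFin f
≤-maxFin f zero    = m≤m⊔n (f zero) _
≤-maxFin f (suc i) = ≤-trans (≤-maxFin (tail f) i) (m≤n⊔m (f zero) _)

corollary5p7 : ∀ {h} (H : Graph h) →
    ∃[ C ] ∃[ n₀ ] (∀ n → n₀ ≤ n → ∀ N → C * n ^ Δ H ≤ N →
      (G : Graph N) → Contains G H ⊎ ComplContainsKnn G n)
corollary5p7 {h} H = h + Δ H , 1 , ramsey
  where
  ramsey : ∀ n → 1 ≤ n → ∀ N → (h + Δ H) * n ^ Δ H ≤ N →
           (G : Graph N) → Contains G H ⊎ ComplContainsKnn G n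
  ramsey n@(suc _) _ N N-large G =
    Sum.swap (Sum.map₂ contains (embed H (λ _ → Δ H) (λ _ → full) ∅
      (≤-reflexive (cong (_+ h) (count-∅ {N})))
      (≤-maxFin (degree H))
      (λ _ → subst ((h + Δ H) * n ^ Δ H ≤_) (sym (count-full {N})) N-large)))
    where open Greedy G n h
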